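{- For every tree $T_r$ rooted at $r$, $T_r$ contains two disjoint homometric sets, each of size at least $f(T_r)$.
   Context: For a rooted tree $T_r$, $h(T_r)$ denotes the number of vertices on a longest path in $T_r$ starting at the root $r$ (so a single vertex has $h=1$); for the empty tree $T_\emptyset$ set $h(T_\emptyset)=0$. For a rooted tree $T_r$ with at least two vertices, let $v_1,\ldots,v_{k'}$ be the children of $r$ and $T_{v_i}$ the subtree rooted at $v_i$ consisting of $v_i$ and its descendants, ordered so that $h(T_{v_1})\ge h(T_{v_2})\ge\cdots\ge h(T_{v_{k'}})$; if $k'$ is even put $k=k'$, and if $k'$ is odd put $k=k'+1$ and $T_{v_k}=T_\emptyset$. The function $f$ is defined recursively by $f(T_r)=0$ if $T_r$ has at most one vertex (including the empty tree), and otherwise $$f(T_r)=\max\Big\{\sum_{i=1}^{k} f(T_{v_i}),\ \sum_{i=1}^{k/2} h(T_{v_{2i}})\Big\}.$$ For $V'\subseteq V(T_r)$, the profile of $V'$ is the multiset of pairwise distances in $T_r$ between vertices of $V'$; two disjoint vertex sets are homometric if their profiles are equal. -}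

module Defs where

open import Data.Nat using (ℕ; zero; suc; _+_; _⊔_; _≤_; _≡ᵇ_)
open import Data.Nat.Properties using (≤-decTotalOrder)
open import Data.Bool using (Bool; true; false; if_then_else_; T)
open import Data.List using (List; []; _∷_; length; map; _++_; reverse; sum)
open import Data.List.Sort using (sort)
open import Data.List.Membership.Propositional using (_∈_)
open import Data.List.Relation.Unary.All using (All)
open import Data.List.Relation.Unary.Unique.Propositional using (Unique)
open import Data.List.Relation.Binary.Permutation.Propositional using (_↭_)
open import Data.Product using (_×_)
open import Relation.Nullary using (¬_)

data RTree : Set where
  node : List RTree → RTree

mutual
  -- number of vertices on a longest path starting at the root
  h : RTree → ℕ
  h (node ts) = suc (maxH ts)

  maxH : List RTree → ℕ
  maxH []       = 0
  maxH (t ∷ ts) = h t ⊔ maxH ts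

mutual
  hs : List RTree → List ℕ
  hs []       = []
  hs (t ∷ ts) = h t ∷ hs ts

sortDesc : List ℕ → List ℕ
sortDesc xs = reverse (sort ≤-decTotalOrder xs)

evenSum : List ℕ → ℕ
evenSum []           = 0
evenSum (_ ∷ [])     = 0
evenSum (_ ∷ y ∷ ys) = y + evenSum ys

mutual
  f : RTree → ℕ
  f (node [])       = 0
  f (node (t ∷ ts)) = sumF (t ∷ ts) ⊔ evenSum (sortDesc (hs (t ∷ ts)))

  sumF : List RTree → ℕ
  sumF []       = 0
  sumF (t ∷ ts) = f t + sumF ts

-- Vertices as addresses: a list of child indices from the root.

mutual
  valid : RTree → List ℕ → Bool
  valid (node ts) []      = true
  valid (node ts) (i ∷ p) = validAt ts i p

  validAt : List RTree → ℕ → List ℕ → Bool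
  validAt []       _       _ = false
  validAt (t ∷ ts) zero    p = valid t p
  validAt (t ∷ ts) (suc i) p = validAt ts i p

Vertex : RTree → List ℕ → Set
Vertex t p = T (valid t p)

dist : List ℕ → List ℕ → ℕ
dist (x ∷ xs) (y ∷ ys) =
  if x ≡ᵇ y then dist xs ys else length (x ∷ xs) + length (y ∷ ys)
dist xs ys = length xs + length ys

IsVertexSet : RTree → List (List ℕ) → Set
IsVertexSet t V = Unique V × All (Vertex t) V

profile : List (List ℕ) → List ℕ
profile []       = []
profile (x ∷ xs) = map (dist x) xs ++ profile xs

Disjoint : List (List ℕ) → List (List ℕ) → Set
Disjoint A B = ∀ {p} → p ∈ A → ¬ (p ∈ B)

Homometric : List (List ℕ) → List (List ℕ) → Set
Homometric A B = Disjoint A B × (profile A ↭ profile B)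

-- Call two vertex lists A, B congruent when matching them position by position
-- preserves all pairwise distances and all depths; congruent disjoint vertex
-- sets are homometric. If the pairs (A₁, B₁) and (A₂, B₂) are congruent and lie
-- in the subtrees of different children of the root, every distance between
-- the two pairs passes through the root and is a sum of depths, so A₁ ++ A₂ and
-- B₁ ++ B₂ are congruent again. Combining the pairs found recursively in all
-- children gives the first bound of f. For the second, sort the children by
-- height and pair them up consecutively: for a pair u, v, the first h u ⊓ h v
-- vertices of a longest path in u and of one in v form two congruent lists.

module Submission where

open import Defs
open import Function using (_∘_; flip)
open import Data.Nat using (ℕ; zero; suc; _+_; _⊔_; _⊓_; _≤_; _≥_; ∣_-_∣; z≤n; s≤s)
open import Data.Nat.Properties
  using (≤-decTotalOrder; ≤-trans; ≤-reflexive; +-mono-≤; +-identityʳ; ⊔-sel; ⊔-identityʳ;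
         m≤n⇒m≤1+n; m⊓n≤m; m⊓n≤n; m≤n⇒m⊓n≡m; m≥n⇒m⊓n≡n; suc-injective)
open import Data.List using (List; []; _∷_; [_]; length; map; _++_; reverse; reverseAcc; take; downFrom)
open import Data.List.Properties
  using (map-++; map-∘; map-cong; map-cong-local; length-map; length-++; length-take; ∷-injectiveˡ; ∷-injectiveʳ)
open import Data.List.Sort using (sort-↭; sort-↗)
open import Data.List.Membership.Propositional using (_∈_)
open import Data.List.Membership.Propositional.Properties using (∈-++⁺ˡ; ∈-++⁺ʳ; ∈-++⁻; ∈-map⁻)
open import Data.List.Relation.Unary.All as All using (All; []; _∷_)
import Data.List.Relation.Unary.All.Properties as All
open import Data.List.Relation.Unary.Any using (here; there)
open import Data.List.Relation.Unary.AllPairs using ([]; _∷_)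
open import Data.List.Relation.Unary.Linked as Linked using (Linked; []; [-]; _∷_)
open import Data.List.Relation.Unary.Unique.Propositional using (Unique)
import Data.List.Relation.Unary.Unique.Propositional.Properties as Unique
open import Data.List.Relation.Binary.Permutation.Propositional using (_↭_; ↭-sym; ↭-trans; ↭-reflexive; ↭⇒↭ₛ)
open import Data.List.Relation.Binary.Permutation.Propositional.Properties
  using (All-resp-↭; ↭-reverse; ↭-map-inv)
  renaming (map⁺ to ↭-map⁺)
import Data.List.Relation.Binary.Permutation.Setoid.Properties as Permutationₛ
open import Data.Product using (Σ; _×_; _,_; proj₁; proj₂; map₁; uncurry)
open import Data.Sum using (inj₁; inj₂)
open import Data.Unit using (tt)
open import Data.Empty using (⊥-elim)
open import Data.Bool using (T)
open import Relation.Binary.Core using (Rel)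
open import Relation.Binary.PropositionalEquality
  using (_≡_; _≢_; refl; sym; trans; cong; cong₂; subst; setoid; module ≡-Reasoning)

dist-common-head : ∀ i x y → dist (i ∷ x) (i ∷ y) ≡ dist x y
dist-common-head zero    x y = refl
dist-common-head (suc i) x y = dist-common-head i x y

dist-distinct-heads : ∀ {i j} x y → i ≢ j → dist (i ∷ x) (j ∷ y) ≡ length (i ∷ x) + length (j ∷ y)
dist-distinct-heads {zero}  {zero}  x y i≢j = ⊥-elim (i≢j refl)
dist-distinct-heads {zero}  {suc j} x y i≢j = refl
dist-distinct-heads {suc i} {zero}  x y i≢j = refl
dist-distinct-heads {suc i} {suc j} x y i≢j = dist-distinct-heads x y (i≢j ∘ cong suc)

length-take-≤ : ∀ {k} (p : List ℕ) → k ≤ length p → length (take k p) ≡ k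
length-take-≤ {k} p k≤ = trans (length-take k p) (m≤n⇒m⊓n≡m k≤)

dist-take : ∀ {k l} (p : List ℕ) → k ≤ length p → l ≤ length p →
            dist (take k p) (take l p) ≡ ∣ k - l ∣
dist-take {zero}          p       _         l≤        = length-take-≤ p l≤
dist-take {suc k} {zero}  (x ∷ p) (s≤s k≤)  _         =
  trans (+-identityʳ _) (cong suc (length-take-≤ p k≤))
dist-take {suc k} {suc l} (x ∷ p) (s≤s k≤)  (s≤s l≤)  =
  trans (dist-common-head x (take k p) (take l p)) (dist-take p k≤ l≤)

-- The root lies on the path between x and y.
ThroughRoot : List ℕ → List ℕ → Set
ThroughRoot x y = dist x y ≡ length x + length y

Separated : List ℕ → List ℕ → Set
Separated x y = x ≢ y × ThroughRoot x y

infix 4 _≅_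
data _≅_ : List (List ℕ) → List (List ℕ) → Set where
  []   : [] ≅ []
  cons : ∀ {a b A B} → length a ≡ length b → map (dist a) A ≡ map (dist b) B → A ≅ B → a ∷ A ≅ b ∷ B

≅⇒profile≡ : ∀ {A B} → A ≅ B → profile A ≡ profile B
≅⇒profile≡ []                = refl
≅⇒profile≡ (cons _ a≡b A≅B) = cong₂ _++_ a≡b (≅⇒profile≡ A≅B)

≅⇒length≡ : ∀ {A B} → A ≅ B → length A ≡ length B
≅⇒length≡ []              = refl
≅⇒length≡ (cons _ _ A≅B) = cong suc (≅⇒length≡ A≅B)

≅⇒depths≡ : ∀ {A B} → A ≅ B → map length A ≡ map length B
≅⇒depths≡ []              = refl
≅⇒depths≡ (cons a≡b _ A≅B) = cong₂ _∷_ a≡b (≅⇒depths≡ A≅B)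

map-dist-∷ : ∀ i a X → map (dist (i ∷ a)) (map (i ∷_) X) ≡ map (dist a) X
map-dist-∷ i a X = trans (sym (map-∘ X)) (map-cong (dist-common-head i a) X)

≅-map-∷ : ∀ {i j A B} → A ≅ B → map (i ∷_) A ≅ map (j ∷_) B
≅-map-∷                 []                  = []
≅-map-∷ {i} {j} {a ∷ A} {b ∷ B} (cons a≡b da≡db A≅B) =
  cons (cong suc a≡b) (trans (map-dist-∷ i a A) (trans da≡db (sym (map-dist-∷ j b B)))) (≅-map-∷ A≅B)

map-dist-throughRoot : ∀ x Y → All (ThroughRoot x) Y → map (dist x) Y ≡ map (length x +_) (map length Y)
map-dist-throughRoot x Y through = trans (map-cong-local through) (map-∘ Y)

≅-++ : ∀ {A₁ B₁ A₂ B₂} → A₁ ≅ B₁ → A₂ ≅ B₂ →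
       All (λ x → All (ThroughRoot x) A₂) A₁ → All (λ y → All (ThroughRoot y) B₂) B₁ →
       A₁ ++ A₂ ≅ B₁ ++ B₂
≅-++ [] A₂≅B₂ _ _ = A₂≅B₂
≅-++ {a ∷ A₁} {b ∷ B₁} {A₂} {B₂} (cons a≡b da≡db A₁≅B₁) A₂≅B₂ (ta ∷ tas) (tb ∷ tbs) =
  cons a≡b dists (≅-++ A₁≅B₁ A₂≅B₂ tas tbs)
  where
  dists : map (dist a) (A₁ ++ A₂) ≡ map (dist b) (B₁ ++ B₂)
  dists = begin
    map (dist a) (A₁ ++ A₂)
      ≡⟨ map-++ (dist a) A₁ A₂ ⟩
    map (dist a) A₁ ++ map (dist a) A₂
      ≡⟨ cong (map (dist a) A₁ ++_) (map-dist-throughRoot a A₂ ta) ⟩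
    map (dist a) A₁ ++ map (length a +_) (map length A₂)
      ≡⟨ cong₂ (λ M k → M ++ map (k +_) (map length A₂)) da≡db a≡b ⟩
    map (dist b) B₁ ++ map (length b +_) (map length A₂)
      ≡⟨ cong (λ L → map (dist b) B₁ ++ map (length b +_) L) (≅⇒depths≡ A₂≅B₂) ⟩
    map (dist b) B₁ ++ map (length b +_) (map length B₂)
      ≡⟨ cong (map (dist b) B₁ ++_) (sym (map-dist-throughRoot b B₂ tb)) ⟩
    map (dist b) B₁ ++ map (dist b) B₂
      ≡⟨ sym (map-++ (dist b) B₁ B₂) ⟩
    map (dist b) (B₁ ++ B₂)
      ∎
    where open ≡-Reasoning

record HomPair (t : RTree) (A B : List (List ℕ)) : Set where
  field
    vertexSetA : IsVertexSet t A
    vertexSetB : IsVertexSet t B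
    disjoint   : Disjoint A B
    congruent  : A ≅ B
open HomPair

HomPair⇒Homometric : ∀ {t A B} → HomPair t A B → Homometric A B
HomPair⇒Homometric P = disjoint P , ↭-reflexive (≅⇒profile≡ (congruent P))

[]-HomPair : ∀ {t} → HomPair t [] []
[]-HomPair = record { vertexSetA = [] , [] ; vertexSetB = [] , [] ; disjoint = λ () ; congruent = [] }

module _ {P Q : List ℕ → Set} (separated : ∀ {x y} → P x → Q y → Separated x y) where

  ++-isVertexSet : ∀ {t X Y} → IsVertexSet t X → IsVertexSet t Y → All P X → All Q Y →
                   IsVertexSet t (X ++ Y)
  ++-isVertexSet (uX , vX) (uY , vY) pX qY =
    Unique.++⁺ uX uY (λ (x∈X , x∈Y) → proj₁ (separated (All.lookup pX x∈X) (All.lookup qY x∈Y)) refl) ,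
    All.++⁺ vX vY

  throughRoot-all : ∀ {X Y} → All P X → All Q Y → All (λ x → All (ThroughRoot x) Y) X
  throughRoot-all pX qY = All.map (λ px → All.map (λ qy → proj₂ (separated px qy)) qY) pX

  HomPair-++ : ∀ {t A₁ B₁ A₂ B₂} →
               HomPair t A₁ B₁ → All P A₁ → All P B₁ →
               HomPair t A₂ B₂ → All Q A₂ → All Q B₂ →
               HomPair t (A₁ ++ A₂) (B₁ ++ B₂)
  HomPair-++ {t} {A₁} {B₁} {A₂} {B₂} P₁ pA₁ pB₁ P₂ qA₂ qB₂ = record
    { vertexSetA = ++-isVertexSet {t} (vertexSetA P₁) (vertexSetA P₂) pA₁ qA₂
    ; vertexSetB = ++-isVertexSet {t} (vertexSetB P₁) (vertexSetB P₂) pB₁ qB₂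
    ; disjoint   = disjoint-++
    ; congruent  = ≅-++ (congruent P₁) (congruent P₂) (throughRoot-all pA₁ qA₂) (throughRoot-all pB₁ qB₂)
    }
    where
    disjoint-++ : Disjoint (A₁ ++ A₂) (B₁ ++ B₂)
    disjoint-++ x∈A x∈B with ∈-++⁻ A₁ x∈A | ∈-++⁻ B₁ x∈B
    ... | inj₁ x∈A₁ | inj₁ x∈B₁ = disjoint P₁ x∈A₁ x∈B₁
    ... | inj₁ x∈A₁ | inj₂ x∈B₂ = proj₁ (separated (All.lookup pA₁ x∈A₁) (All.lookup qB₂ x∈B₂)) refl
    ... | inj₂ x∈A₂ | inj₁ x∈B₁ = proj₁ (separated (All.lookup pB₁ x∈B₁) (All.lookup qA₂ x∈A₂)) refl
    ... | inj₂ x∈A₂ | inj₂ x∈B₂ = disjoint P₂ x∈A₂ x∈B₂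

record HomPairOfSize (t : RTree) (n : ℕ) : Set where
  field
    {A B}   : List (List ℕ)
    homPair : HomPair t A B
    large   : n ≤ length A

⊔-HomPairOfSize : ∀ {t m n} → HomPairOfSize t m → HomPairOfSize t n → HomPairOfSize t (m ⊔ n)
⊔-HomPairOfSize {t} {m} {n} P Q with ⊔-sel m n
... | inj₁ m⊔n≡m = subst (HomPairOfSize t) (sym m⊔n≡m) P
... | inj₂ m⊔n≡n = subst (HomPairOfSize t) (sym m⊔n≡n) Q

data InBranch (I : List ℕ) : List ℕ → Set where
  inBranch : ∀ {i p} → i ∈ I → InBranch I (i ∷ p)

unique-++⇒≢ : ∀ (I : List ℕ) {J i j} → Unique (I ++ J) → i ∈ I → j ∈ J → i ≢ j
unique-++⇒≢ (_ ∷ I) {J} (i≢ ∷ _) (here refl) j∈J = All.lookup i≢ (∈-++⁺ʳ I {J} j∈J)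
unique-++⇒≢ (_ ∷ I) (_ ∷ u)  (there i∈I) j∈J = unique-++⇒≢ I u i∈I j∈J

inBranch-separated : ∀ {I J x y} → Unique (I ++ J) → InBranch I x → InBranch J y → Separated x y
inBranch-separated {I} {x = i ∷ x} {j ∷ y} u (inBranch i∈I) (inBranch j∈J) =
  i≢j ∘ ∷-injectiveˡ , dist-distinct-heads x y i≢j
  where
  i≢j : i ≢ j
  i≢j = unique-++⇒≢ I u i∈I j∈J

inBranch-++⁺ˡ : ∀ {I J x} → InBranch I x → InBranch (I ++ J) x
inBranch-++⁺ˡ (inBranch i∈I) = inBranch (∈-++⁺ˡ i∈I)

inBranch-++⁺ʳ : ∀ I {J x} → InBranch J x → InBranch (I ++ J) x
inBranch-++⁺ʳ I (inBranch j∈J) = inBranch (∈-++⁺ʳ I j∈J)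

map-∷-inBranch : ∀ {I i} → i ∈ I → ∀ X → All (InBranch I) (map (i ∷_) X)
map-∷-inBranch i∈I X = All.map⁺ (All.universal (λ _ → inBranch i∈I) X)

record BranchPair (ts : List RTree) (I : List ℕ) (n : ℕ) : Set where
  field
    {A B}   : List (List ℕ)
    homPair : HomPair (node ts) A B
    branchA : All (InBranch I) A
    branchB : All (InBranch I) B
    large   : n ≤ length A

BranchPair⇒HomPairOfSize : ∀ {ts I n} → BranchPair ts I n → HomPairOfSize (node ts) n
BranchPair⇒HomPairOfSize P = record { homPair = BranchPair.homPair P ; large = BranchPair.large P }

[]-BranchPair : ∀ {ts I} → BranchPair ts I 0
[]-BranchPair = record { homPair = []-HomPair ; branchA = [] ; branchB = [] ; large = z≤n }

BranchPair-++ : ∀ {ts I J m n} → BranchPair ts I m → BranchPair ts J n → Unique (I ++ J) →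
                BranchPair ts (I ++ J) (m + n)
BranchPair-++ {I = I} P Q u = record
  { homPair = HomPair-++ (inBranch-separated u) (homPair P) (branchA P) (branchB P)
                                                (homPair Q) (branchA Q) (branchB Q)
  ; branchA = All.++⁺ (All.map inBranch-++⁺ˡ (branchA P)) (All.map (inBranch-++⁺ʳ I) (branchA Q))
  ; branchB = All.++⁺ (All.map inBranch-++⁺ˡ (branchB P)) (All.map (inBranch-++⁺ʳ I) (branchB Q))
  ; large   = ≤-trans (+-mono-≤ (large P) (large Q)) (≤-reflexive (sym (length-++ (A P))))
  }
  where open BranchPair

data ChildAt : List RTree → ℕ → RTree → Set where
  firstChild : ∀ {u ts} → ChildAt (u ∷ ts) 0 u
  laterChild : ∀ {t ts i u} → ChildAt ts i u → ChildAt (t ∷ ts) (suc i) u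

child-vertex : ∀ {ts i u p} → ChildAt ts i u → Vertex u p → Vertex (node ts) (i ∷ p)
child-vertex firstChild     v = v
child-vertex (laterChild c) v = child-vertex c v

map-∷-isVertexSet : ∀ {ts i u X} → ChildAt ts i u → IsVertexSet u X → IsVertexSet (node ts) (map (i ∷_) X)
map-∷-isVertexSet c (uX , vX) = Unique.map⁺ ∷-injectiveʳ uX , All.map⁺ (All.map (child-vertex c) vX)

map-∷-disjoint : ∀ {i j X Y} → (i ≡ j → Disjoint X Y) → Disjoint (map (i ∷_) X) (map (j ∷_) Y)
map-∷-disjoint {i} {j} disj x∈ y∈ with ∈-map⁻ (i ∷_) x∈ | ∈-map⁻ (j ∷_) y∈
... | a , a∈X , refl | b , b∈Y , eq =
  disj (∷-injectiveˡ eq) a∈X (subst (_∈ _) (sym (∷-injectiveʳ eq)) b∈Y)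

childBranchPair : ∀ {ts i u n} → ChildAt ts i u → HomPairOfSize u n → BranchPair ts [ i ] n
childBranchPair {i = i} c P = record
  { homPair = record
    { vertexSetA = map-∷-isVertexSet c (vertexSetA (homPair P))
    ; vertexSetB = map-∷-isVertexSet c (vertexSetB (homPair P))
    ; disjoint   = map-∷-disjoint (λ _ → disjoint (homPair P))
    ; congruent  = ≅-map-∷ (congruent (homPair P))
    }
  ; branchA = map-∷-inBranch (here refl) (A P)
  ; branchB = map-∷-inBranch (here refl) (B P)
  ; large   = ≤-trans (large P) (≤-reflexive (sym (length-map (i ∷_) (A P))))
  }
  where open HomPairOfSize

mutual
  longestPath : (u : RTree) → Σ (List ℕ) λ p → Vertex u p × suc (length p) ≡ h u
  longestPath (node [])       = [] , tt , refl
  longestPath (node (t ∷ ts)) =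
    let i , p , v , e = longestPathFrom t ts in i ∷ p , v , cong suc e

  longestPathFrom : (t : RTree) (ts : List RTree) →
    Σ ℕ λ i → Σ (List ℕ) λ p → Vertex (node (t ∷ ts)) (i ∷ p) × suc (length p) ≡ maxH (t ∷ ts)
  longestPathFrom t [] =
    let p , v , e = longestPath t in 0 , p , v , trans e (sym (⊔-identityʳ (h t)))
  longestPathFrom t (t′ ∷ ts) with ⊔-sel (h t) (maxH (t′ ∷ ts))
  ... | inj₁ ≡h =
    let p , v , e = longestPath t in 0 , p , v , trans e (sym ≡h)
  ... | inj₂ ≡maxH =
    let i , p , v , e = longestPathFrom t′ ts in suc i , p , v , trans e (sym ≡maxH)

mutual
  vertex-take : ∀ u k {p} → Vertex u p → Vertex u (take k p)
  vertex-take (node us) zero    _         = tt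
  vertex-take (node us) (suc k) {[]}    _ = tt
  vertex-take (node us) (suc k) {i ∷ p} v = vertexAt-take us i k v

  vertexAt-take : ∀ us i k {p} → T (validAt us i p) → T (validAt us i (take k p))
  vertexAt-take (u ∷ us) zero    k v = vertex-take u k v
  vertexAt-take (u ∷ us) (suc i) k v = vertexAt-take us i k v

prefixes : List ℕ → ℕ → List (List ℕ)
prefixes p zero    = []
prefixes p (suc m) = take m p ∷ prefixes p m

length-prefixes : ∀ p m → length (prefixes p m) ≡ m
length-prefixes p zero    = refl
length-prefixes p (suc m) = cong suc (length-prefixes p m)

map-length-prefixes : ∀ p m → m ≤ suc (length p) → map length (prefixes p m) ≡ downFrom m
map-length-prefixes p zero    _        = refl
map-length-prefixes p (suc m) (s≤s m≤) =
  cong₂ _∷_ (length-take-≤ p m≤) (map-length-prefixes p m (m≤n⇒m≤1+n m≤))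

map-dist-prefixes : ∀ {k} p m → k ≤ length p → m ≤ suc (length p) →
                    map (dist (take k p)) (prefixes p m) ≡ map (λ l → ∣ k - l ∣) (downFrom m)
map-dist-prefixes p zero    _  _        = refl
map-dist-prefixes p (suc m) k≤ (s≤s m≤) =
  cong₂ _∷_ (dist-take p k≤ m≤) (map-dist-prefixes p m k≤ (m≤n⇒m≤1+n m≤))

prefixes-≅ : ∀ p q m → m ≤ suc (length p) → m ≤ suc (length q) → prefixes p m ≅ prefixes q m
prefixes-≅ p q zero    _        _        = []
prefixes-≅ p q (suc m) (s≤s m≤p) (s≤s m≤q) =
  cons (trans (length-take-≤ p m≤p) (sym (length-take-≤ q m≤q)))
       (trans (map-dist-prefixes p m m≤p (m≤n⇒m≤1+n m≤p))
              (sym (map-dist-prefixes q m m≤q (m≤n⇒m≤1+n m≤q))))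
       (prefixes-≅ p q m (m≤n⇒m≤1+n m≤p) (m≤n⇒m≤1+n m≤q))

-- Distinct depths make the prefixes distinct.
prefixes-isVertexSet : ∀ u {p} m → Vertex u p → m ≤ suc (length p) → IsVertexSet u (prefixes p m)
prefixes-isVertexSet u {p} m v m≤ =
  Unique.map⁻ (subst Unique (sym (map-length-prefixes p m m≤)) (Unique.downFrom⁺ m)) ,
  all-vertex m
  where
  all-vertex : ∀ m → All (Vertex u) (prefixes p m)
  all-vertex zero    = []
  all-vertex (suc m) = vertex-take u m v ∷ all-vertex m

spineBranchPair : ∀ {ts i j u v} → ChildAt ts i u → ChildAt ts j v → i ≢ j →
                  BranchPair ts (i ∷ j ∷ []) (h u ⊓ h v)
spineBranchPair {i = i} {j} {u} {v} cu cv i≢j with longestPath u | longestPath v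
... | p , vp , p≡ | q , vq , q≡ = record
  { homPair = record
    { vertexSetA = map-∷-isVertexSet cu (prefixes-isVertexSet u m vp m≤p)
    ; vertexSetB = map-∷-isVertexSet cv (prefixes-isVertexSet v m vq m≤q)
    ; disjoint   = map-∷-disjoint (⊥-elim ∘ i≢j)
    ; congruent  = ≅-map-∷ (prefixes-≅ p q m m≤p m≤q)
    }
  ; branchA = map-∷-inBranch (here refl) (prefixes p m)
  ; branchB = map-∷-inBranch (there (here refl)) (prefixes q m)
  ; large   = ≤-reflexive (sym (trans (length-map (i ∷_) (prefixes p m)) (length-prefixes p m)))
  }
  where
  m = h u ⊓ h v
  m≤p : m ≤ suc (length p)
  m≤p = ≤-trans (m⊓n≤m (h u) (h v)) (≤-reflexive (sym p≡))
  m≤q : m ≤ suc (length q)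
  m≤q = ≤-trans (m⊓n≤n (h u) (h v)) (≤-reflexive (sym q≡))

IndexedChildren : List RTree → List (ℕ × RTree) → Set
IndexedChildren ts cs = Unique (map proj₁ cs) × All (uncurry (ChildAt ts)) cs

IndexedChildren-resp-↭ : ∀ {ts cs zs} → cs ↭ zs → IndexedChildren ts cs → IndexedChildren ts zs
IndexedChildren-resp-↭ cs↭zs (u , c) =
  Permutationₛ.Unique-resp-↭ (setoid ℕ) (↭⇒↭ₛ (↭-map⁺ proj₁ cs↭zs)) u , All-resp-↭ cs↭zs c

children : List RTree → List (ℕ × RTree)
children []       = []
children (t ∷ ts) = (0 , t) ∷ map (map₁ suc) (children ts)

map-proj₂-children : ∀ ts → map proj₂ (children ts) ≡ ts
map-proj₂-children []       = refl
map-proj₂-children (t ∷ ts) = cong (t ∷_) (trans (sym (map-∘ (children ts))) (map-proj₂-children ts))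

children-indexed : ∀ ts → IndexedChildren ts (children ts)
children-indexed []       = [] , []
children-indexed (t ∷ ts) =
  let u , c = children-indexed ts in
  subst (λ is → Unique (0 ∷ is)) indices
        (All.map⁺ (All.universal (λ _ ()) _) ∷ Unique.map⁺ suc-injective u) ,
  firstChild ∷ All.map⁺ (All.map laterChild c)
  where
  indices : map suc (map proj₁ (children ts)) ≡ map proj₁ (map (map₁ suc) (children ts))
  indices = trans (sym (map-∘ {g = suc} {f = proj₁} (children ts))) (map-∘ (children ts))

sumBranchPair : ∀ {ts} cs → IndexedChildren ts cs → All (λ u → HomPairOfSize u (f u)) (map proj₂ cs) →
                BranchPair ts (map proj₁ cs) (sumF (map proj₂ cs))
sumBranchPair []       _                  _        = []-BranchPair
sumBranchPair (_ ∷ cs) (u ∷ us , c ∷ cs′) (P ∷ Ps) =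
  BranchPair-++ (childBranchPair c P) (sumBranchPair cs (us , cs′) Ps) (u ∷ us)

sumHomPair : ∀ ts → All (λ u → HomPairOfSize u (f u)) ts → HomPairOfSize (node ts) (sumF ts)
sumHomPair ts Ps =
  subst (HomPairOfSize (node ts)) (cong sumF (map-proj₂-children ts))
        (BranchPair⇒HomPairOfSize
          (sumBranchPair (children ts) (children-indexed ts)
                         (subst (All _) (sym (map-proj₂-children ts)) Ps)))

pairMins : List ℕ → ℕ
pairMins (x ∷ y ∷ xs) = x ⊓ y + pairMins xs
pairMins _            = 0

pairBranchPair : ∀ {ts} cs → IndexedChildren ts cs →
                 BranchPair ts (map proj₁ cs) (pairMins (map (h ∘ proj₂) cs))
pairBranchPair []           _ = []-BranchPair
pairBranchPair (_ ∷ [])     _ = []-BranchPair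
pairBranchPair (_ ∷ _ ∷ cs) (u@((i≢j ∷ _) ∷ _ ∷ us) , ci ∷ cj ∷ cs′) =
  BranchPair-++ (spineBranchPair ci cj i≢j) (pairBranchPair cs (us , cs′)) u

reverseAcc-linked : ∀ {a ℓ} {A : Set a} {R : Rel A ℓ} {x xs acc} →
                    Linked R (x ∷ xs) → Linked (flip R) (x ∷ acc) → Linked (flip R) (reverseAcc (x ∷ acc) xs)
reverseAcc-linked [-]       l = l
reverseAcc-linked (r ∷ rs) l = reverseAcc-linked rs (r ∷ l)

reverse-linked : ∀ {a ℓ} {A : Set a} {R : Rel A ℓ} {xs} → Linked R xs → Linked (flip R) (reverse xs)
reverse-linked {xs = []}    _ = []
reverse-linked {xs = _ ∷ _} l = reverseAcc-linked l [-]

sortDesc-descending : ∀ xs → Linked _≥_ (sortDesc xs)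
sortDesc-descending xs = reverse-linked (sort-↗ ≤-decTotalOrder xs)

evenSum≡pairMins : ∀ {xs} → Linked _≥_ xs → evenSum xs ≡ pairMins xs
evenSum≡pairMins []        = refl
evenSum≡pairMins [-]       = refl
evenSum≡pairMins (x≥y ∷ l) = cong₂ _+_ (sym (m≥n⇒m⊓n≡n x≥y)) (evenSum≡pairMins (Linked.tail l))

sortDesc-↭ : ∀ xs → sortDesc xs ↭ xs
sortDesc-↭ xs = ↭-trans (↭-reverse _) (sort-↭ ≤-decTotalOrder xs)

hs≡map-h : ∀ ts → hs ts ≡ map h ts
hs≡map-h []       = refl
hs≡map-h (t ∷ ts) = cong (h t ∷_) (hs≡map-h ts)

map-h-children : ∀ ts → map (h ∘ proj₂) (children ts) ≡ hs ts
map-h-children ts = begin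
  map (h ∘ proj₂) (children ts)    ≡⟨ map-∘ (children ts) ⟩
  map h (map proj₂ (children ts))  ≡⟨ cong (map h) (map-proj₂-children ts) ⟩
  map h ts                         ≡⟨ sym (hs≡map-h ts) ⟩
  hs ts                            ∎
  where open ≡-Reasoning

evenHomPair : ∀ ts → HomPairOfSize (node ts) (evenSum (sortDesc (hs ts)))
evenHomPair ts
  with ↭-map-inv (h ∘ proj₂) (↭-trans (↭-reflexive (map-h-children ts)) (↭-sym (sortDesc-↭ (hs ts))))
... | zs , sorted≡ , cs↭zs =
  subst (HomPairOfSize (node ts)) size≡
        (BranchPair⇒HomPairOfSize (pairBranchPair zs (IndexedChildren-resp-↭ cs↭zs (children-indexed ts))))
  where
  size≡ : pairMins (map (h ∘ proj₂) zs) ≡ evenSum (sortDesc (hs ts))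
  size≡ = trans (sym (evenSum≡pairMins (subst (Linked _≥_) sorted≡ (sortDesc-descending (hs ts)))))
                (cong evenSum (sym sorted≡))

mutual
  homPairOfSize-f : ∀ t → HomPairOfSize t (f t)
  homPairOfSize-f (node [])       = record { homPair = []-HomPair ; large = z≤n }
  homPairOfSize-f (node (t ∷ ts)) =
    ⊔-HomPairOfSize (sumHomPair (t ∷ ts) (homPairsOfSize-f (t ∷ ts))) (evenHomPair (t ∷ ts))

  homPairsOfSize-f : ∀ ts → All (λ t → HomPairOfSize t (f t)) ts
  homPairsOfSize-f []       = []
  homPairsOfSize-f (t ∷ ts) = homPairOfSize-f t ∷ homPairsOfSize-f ts

lemma1 : (t : RTree) →
    Σ (List (List ℕ)) λ A → Σ (List (List ℕ)) λ B →
      IsVertexSet t A × IsVertexSet t B × Homometric A B ×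
      f t ≤ length A × f t ≤ length B
lemma1 t =
  A , B , vertexSetA homPair , vertexSetB homPair , HomPair⇒Homometric homPair ,
  large , subst (f t ≤_) (≅⇒length≡ (congruent homPair)) large
  where open HomPairOfSize (homPairOfSize-f t)
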